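{- Let $\mathbf{C}$ be a category in which every morphism is monic and $\hom_{\mathbf{C}}(A,B)$ is finite for all objects $A,B$, and let $\mathbf{D}$ be a hereditary subcategory of $\mathbf{C}$. If $\mathbf{C}$ has the canonical Ramsey property and $\mathbf{D}$ is closed for binary diagrams, then $\mathbf{D}$ has the canonical Ramsey property.
   Context: A morphism $f$ is monic if $f\cdot g=f\cdot h$ implies $g=h$. $\mathbf{D}$ is a hereditary subcategory of $\mathbf{C}$ if it is a full subcategory and for all $D\in\mathrm{Ob}(\mathbf{D})$, $C\in\mathrm{Ob}(\mathbf{C})$, $\hom_{\mathbf{C}}(C,D)\neq\varnothing$ implies $C\in\mathrm{Ob}(\mathbf{D})$. A binary digraph is a finite acyclic bipartite digraph in which all arrows go from one class of vertices (bottom row) to the other (top row) and every vertex of the bottom row has out-degree 2. A diagram of shape $\Delta$ in a category is a multigraph homomorphism from $\Delta$ to the category (vertices to objects, arrows $\delta\to\gamma$ to morphisms $F(\delta)\to F(\gamma)$). A binary diagram in $\mathbf{C}$ is a diagram $F:\Delta\to\mathbf{C}$ with $\Delta$ a binary digraph such that $F$ maps all bottom-row vertices to one and the same object and all top-row vertices to one and the same object. A commutative cocone over $F$ in a category is an object $C$ with morphisms $e_\delta:F(\delta)\to C$ for all vertices $\delta$ such that $e_\gamma\cdot F(g)=e_\delta$ for every arrow $g:\delta\to\gamma$. $\mathbf{D}$ is closed for binary diagrams (in $\mathbf{C}$) if every binary diagram in $\mathbf{D}$ that has a commutative cocone in $\mathbf{C}$ has a commutative cocone in $\mathbf{D}$.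 For objects $A,B,C$ of a category, $C\xrightarrow{can}(B)^A$ means: for every $\chi:\hom(A,C)\to\omega$ there exist $w\in\hom(B,C)$, an object $Q$ and $q\in\hom(Q,A)$ such that for all $f,g\in\hom(A,B)$, $\chi(w\cdot f)=\chi(w\cdot g)$ iff $f\cdot q=g\cdot q$. A category has the canonical Ramsey property if for all objects $A,B$ with $\hom(A,B)\neq\varnothing$ there is an object $C$ with $C\xrightarrow{can}(B)^A$. -}

module Defs where

open import Level using (Level; _⊔_; suc)
open import Data.Nat using (ℕ)
open import Data.Fin using (Fin)
open import Data.Product using (Σ; _×_; _,_; proj₁; proj₂; ∃)
open import Relation.Binary.PropositionalEquality using (_≡_)
open import Relation.Nullary using (¬_)
open import Function.Bundles using (_↔_; _⇔_)

-- A (locally small) category; morphism equality is propositional equality.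
-- f ∘ g means "f after g" (the paper's f · g).
record Category (o ℓ : Level) : Set (Level.suc (o ⊔ ℓ)) where
  infixr 9 _∘_
  field
    Obj   : Set o
    Hom   : Obj → Obj → Set ℓ
    id    : ∀ {A} → Hom A A
    _∘_   : ∀ {A B C} → Hom B C → Hom A B → Hom A C
    assoc : ∀ {A B C D} (f : Hom C D) (g : Hom B C) (h : Hom A B) →
            (f ∘ g) ∘ h ≡ f ∘ (g ∘ h)
    identityˡ : ∀ {A B} (f : Hom A B) → id ∘ f ≡ f
    identityʳ : ∀ {A B} (f : Hom A B) → f ∘ id ≡ f

module _ {o ℓ : Level} (𝐂 : Category o ℓ) where
  open Category 𝐂

  Monic : ∀ {A B} → Hom A B → Set (o ⊔ ℓ)
  Monic {A} f = ∀ {X} (g h : Hom X A) → f ∘ g ≡ f ∘ h → g ≡ h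

  AllMonic : Set (o ⊔ ℓ)
  AllMonic = ∀ {A B} (f : Hom A B) → Monic f

  LocallyFinite : Set (o ⊔ ℓ)
  LocallyFinite = ∀ (A B : Obj) → Σ ℕ λ n → Hom A B ↔ Fin n

  CanArrow : Obj → Obj → Obj → Set (o ⊔ ℓ)
  CanArrow C B A =
    ∀ (χ : Hom A C → ℕ) →
      Σ (Hom B C) λ w → Σ Obj λ Q → Σ (Hom Q A) λ q →
        ∀ (f g : Hom A B) → (χ (w ∘ f) ≡ χ (w ∘ g)) ⇔ (f ∘ q ≡ g ∘ q)

  CanonicalRamsey : Set (o ⊔ ℓ)
  CanonicalRamsey = ∀ (A B : Obj) → Hom A B → Σ Obj λ C → CanArrow C B A

  FullSub : ∀ {p} (P : Obj → Set p) → Category (o ⊔ p) ℓ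
  FullSub P = record
    { Obj = Σ Obj P
    ; Hom = λ X Y → Hom (proj₁ X) (proj₁ Y)
    ; id = id
    ; _∘_ = _∘_
    ; assoc = assoc
    ; identityˡ = identityˡ
    ; identityʳ = identityʳ
    }

  Hereditary : ∀ {p} (P : Obj → Set p) → Set (o ⊔ ℓ ⊔ p)
  Hereditary P = ∀ (C D : Obj) → P D → Hom C D → P C

  -- A binary digraph: bottom row Fin m, top row Fin n; bottom vertex i has
  -- exactly two out-arrows, to the distinct top vertices left i and right i.
  record BinaryDigraph : Set where
    field
      m n   : ℕ
      left  : Fin m → Fin n
      right : Fin m → Fin n
      distinct : ∀ i → ¬ (left i ≡ right i)

  -- A binary diagram of shape Δ with bottom object A and top object B:
  -- the arrow i → left i is sent to lab₁ i, the arrow i → right i to lab₂ i.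
  record BinaryDiagram (Δ : BinaryDigraph) (A B : Obj) : Set ℓ where
    open BinaryDigraph Δ
    field
      lab₁ : Fin m → Hom A B
      lab₂ : Fin m → Hom A B

  Cocone : ∀ {Δ A B} → BinaryDiagram Δ A B → Obj → Set ℓ
  Cocone {Δ} {A} {B} F C =
    Σ (Fin m → Hom A C) λ eBot → Σ (Fin n → Hom B C) λ eTop →
      ∀ i → (eTop (left i) ∘ lab₁ i ≡ eBot i) × (eTop (right i) ∘ lab₂ i ≡ eBot i)
    where open BinaryDigraph Δ
          open BinaryDiagram F

  ClosedForBinaryDiagrams : ∀ {p} (P : Obj → Set p) → Set (o ⊔ ℓ ⊔ p)
  ClosedForBinaryDiagrams P =
    ∀ (Δ : BinaryDigraph) (A B : Obj) → P A → P B → (F : BinaryDiagram Δ A B) →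
      (Σ Obj λ C → Cocone F C) → Σ Obj λ D → P D × Cocone F D

module Submission where

-- Fix A, B in D and take C with C →can (B)^A in C.  The heart of the proof
-- is a binary diagram with bottom vertices all pairs of factorisations
-- (u ∘ f , v ∘ g) of morphisms A → C through B and top vertices two copies
-- of hom(B,C); the vertex (u,f,v,g) is joined to u in the first copy by f
-- and, when u ∘ f ≡ v ∘ g, to v in the second copy by g.  C itself is a
-- cocone, so closure yields D in D with e : hom(B,C) → hom(B,D) preserving
-- every equation u ∘ f ≡ v ∘ g (transfer-equations).  Hence w ∘ f ↦ e w ∘ f
-- is well defined, a colouring χ of hom(A,D) pulls back to hom(A,C), and
-- C →can (B)^A yields D →can (B)^A (canArrow-transfer); heredity moves the
-- witness object Q into D (canArrow-restrict).

open import Defs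
open import Level using (Level) renaming (suc to lsuc)
open import Data.Nat using (ℕ)
open import Data.Fin using (Fin)
open import Data.Fin.Properties using (+↔⊎; *↔×; any?; inj⇒≟)
open import Data.Product using (Σ; ∃; _×_; _,_; proj₁; proj₂)
open import Data.Product.Function.NonDependent.Propositional using (_×-↔_)
open import Data.Sum using (_⊎_; inj₁; inj₂; reduce)
open import Data.Sum.Function.Propositional using (_⊎-↔_)
open import Data.Empty using (⊥-elim)
open import Function.Bundles using (_↔_; _⇔_; Inverse; Injection)
open import Function.Properties.Inverse using (↔-sym; ↔-trans; ↔⇒↣)
open import Relation.Binary.Definitions using (DecidableEquality)
open import Relation.Binary.PropositionalEquality using (_≡_; refl; sym; trans; cong; subst)
open import Relation.Nullary using (Dec; yes; no; ¬_)
open import Relation.Nullary.Decidable using (map′)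
open import Relation.Unary using (Pred; Decidable)

Finite : ∀ {a} → Set a → Set a
Finite X = Σ ℕ λ n → X ↔ Fin n

module _ {a} {X : Set a} (finX : Finite X) where
  private
    module I = Inverse (proj₂ finX)

  finite-≟ : DecidableEquality X
  finite-≟ = inj⇒≟ (↔⇒↣ (proj₂ finX))

  finite-any? : ∀ {q} {Q : Pred X q} → Decidable Q → Dec (∃ Q)
  finite-any? {Q = Q} Q? =
    map′ (λ { (i , qi) → I.from i , qi })
         (λ { (x , qx) → I.to x , subst Q (sym (I.strictlyInverseʳ x)) qx })
         (any? (λ i → Q? (I.from i)))

finite-× : ∀ {a b} {X : Set a} {Y : Set b} → Finite X → Finite Y → Finite (X × Y)
finite-× (_ , X↔) (_ , Y↔) = _ , ↔-trans (X↔ ×-↔ Y↔) (↔-sym *↔×)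

finite-⊎ : ∀ {a b} {X : Set a} {Y : Set b} → Finite X → Finite Y → Finite (X ⊎ Y)
finite-⊎ (_ , X↔) (_ , Y↔) = _ , ↔-trans (X↔ ⊎-↔ Y↔) (↔-sym +↔⊎)

descend : ∀ {a b c} {S : Set a} {H : Set b} {X : Set c} →
  Finite S → DecidableEquality H → (s : S → H) (k : S → X) → X →
  (∀ x y → s x ≡ s y → k x ≡ k y) →
  Σ (H → X) λ φ → ∀ x → φ (s x) ≡ k x
descend {H = H} {X} finS _≟_ s k default k-resp = φ , φ-s
  where
  φ : H → X
  φ h with finite-any? finS (λ x → s x ≟ h)
  ... | yes (x , _) = k x
  ... | no _        = default

  φ-s : ∀ x → φ (s x) ≡ k x
  φ-s x with finite-any? finS (λ y → s y ≟ s x)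
  ... | yes (y , sy≡sx) = k-resp y x sy≡sx
  ... | no none         = ⊥-elim (none (x , refl))

≡-⇔-rewrite : ∀ {a r} {A : Set a} {R : Set r} {x x′ y y′ : A} →
  x ≡ x′ → y ≡ y′ → (x ≡ y) ⇔ R → (x′ ≡ y′) ⇔ R
≡-⇔-rewrite refl refl iff = iff

module _ {o ℓ : Level} (𝐂 : Category o ℓ) where
  open Category 𝐂

  hom-≟ : LocallyFinite 𝐂 → ∀ {X Y} → DecidableEquality (Hom X Y)
  hom-≟ lf {X} {Y} = finite-≟ (lf X Y)

  record FiniteBinaryDiagram (A B : Obj) : Set (lsuc ℓ) where
    field
      Bot Top     : Set ℓ
      finBot      : Finite Bot
      finTop      : Finite Top
      left right  : Bot → Top
      distinct    : ∀ v → ¬ (left v ≡ right v)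
      lab₁ lab₂   : Bot → Hom A B

  -- A commutative cocone with apex X, given by its top legs (the bottom
  -- legs are then determined by either out-arrow).
  TopCocone : ∀ {A B} → FiniteBinaryDiagram A B → Obj → Set ℓ
  TopCocone {B = B} F X =
    Σ (Top → Hom B X) λ e → ∀ v → e (left v) ∘ lab₁ v ≡ e (right v) ∘ lab₂ v
    where open FiniteBinaryDiagram F

  module Enumeration {A B : Obj} (F : FiniteBinaryDiagram A B) where
    open FiniteBinaryDiagram F
    private
      module IB = Inverse (proj₂ finBot)
      module IT = Inverse (proj₂ finTop)

    Δ : BinaryDigraph 𝐂
    Δ = record
      { m = proj₁ finBot ; n = proj₁ finTop
      ; left = λ i → IT.to (left (IB.from i))
      ; right = λ i → IT.to (right (IB.from i))
      ; distinct = λ i eq → distinct (IB.from i) (Injection.injective (↔⇒↣ (proj₂ finTop)) eq)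
      }

    diagram : BinaryDiagram 𝐂 Δ A B
    diagram = record { lab₁ = λ i → lab₁ (IB.from i) ; lab₂ = λ i → lab₂ (IB.from i) }

    toCocone : ∀ {X} → TopCocone F X → Cocone 𝐂 diagram X
    toCocone (e , comm) =
      (λ i → e (left (IB.from i)) ∘ lab₁ (IB.from i)) , (λ j → e (IT.from j)) ,
      λ i → cong (λ t → e t ∘ lab₁ (IB.from i)) (IT.strictlyInverseʳ _) ,
            trans (cong (λ t → e t ∘ lab₂ (IB.from i)) (IT.strictlyInverseʳ _))
                  (sym (comm (IB.from i)))

    fromCocone : ∀ {X} → Cocone 𝐂 diagram X → TopCocone F X
    fromCocone (_ , eTop , comm) = (λ t → eTop (IT.to t)) , commutes
      where
      commutes : ∀ v → eTop (IT.to (left v)) ∘ lab₁ v ≡ eTop (IT.to (right v)) ∘ lab₂ v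
      commutes v =
        subst (λ u → eTop (IT.to (left u)) ∘ lab₁ u ≡ eTop (IT.to (right u)) ∘ lab₂ u)
              (IB.strictlyInverseʳ v)
              (trans (proj₁ (comm (IB.to v))) (sym (proj₂ (comm (IB.to v)))))

  closed-finite : ∀ {p} {P : Obj → Set p} → ClosedForBinaryDiagrams 𝐂 P →
    ∀ {A B C} → P A → P B → (F : FiniteBinaryDiagram A B) → TopCocone F C →
    Σ Obj λ D → P D × TopCocone F D
  closed-finite cl {A} {B} {C} pA pB F cocone =
    let D , pD , cocone′ = cl Δ A B pA pB diagram (C , toCocone cocone)
    in  D , pD , fromCocone cocone′
    where open Enumeration F

  PreservesEquations : ∀ A {B C D} → (Hom B C → Hom B D) → Set ℓ
  PreservesEquations A {B} {C} e =
    ∀ (u v : Hom B C) (f g : Hom A B) → u ∘ f ≡ v ∘ g → e u ∘ f ≡ e v ∘ g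

  module EquationDiagram (lf : LocallyFinite 𝐂) (A B C : Obj) where
    Factorisation : Set ℓ
    Factorisation = Hom B C × Hom A B

    compose : Factorisation → Hom A C
    compose (u , f) = u ∘ f

    -- the partner of (φ , ψ) is ψ when both compose to the same morphism,
    -- and φ itself otherwise (an arrow pair that commutes in every cocone)
    partner : Factorisation × Factorisation → Factorisation
    partner (φ , ψ) with hom-≟ lf (compose φ) (compose ψ)
    ... | yes _ = ψ
    ... | no _  = φ

    partner-compose : ∀ q → compose (proj₁ q) ≡ compose (partner q)
    partner-compose (φ , ψ) with hom-≟ lf (compose φ) (compose ψ)
    ... | yes φ≡ψ = φ≡ψ
    ... | no _    = refl

    partner-equal : ∀ φ ψ → compose φ ≡ compose ψ → partner (φ , ψ) ≡ ψ
    partner-equal φ ψ φ≡ψ with hom-≟ lf (compose φ) (compose ψ)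
    ... | yes _   = refl
    ... | no φ≢ψ  = ⊥-elim (φ≢ψ φ≡ψ)

    diagram : FiniteBinaryDiagram A B
    diagram = record
      { Bot = Factorisation × Factorisation
      ; Top = Hom B C ⊎ Hom B C
      ; finBot = finite-× finFactorisation finFactorisation
      ; finTop = finite-⊎ (lf B C) (lf B C)
      ; left = λ q → inj₁ (proj₁ (proj₁ q))
      ; right = λ q → inj₂ (proj₁ (partner q))
      ; distinct = λ _ ()
      ; lab₁ = λ q → proj₂ (proj₁ q)
      ; lab₂ = λ q → proj₂ (partner q)
      }
      where
      finFactorisation : Finite Factorisation
      finFactorisation = finite-× (lf B C) (lf A B)

    tautological : TopCocone diagram C
    tautological = reduce , partner-compose

    -- In any cocone, an equation u ∘ f ≡ v ∘ g becomes one between the first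
    -- copy of u and the second copy of v, hence (taking v ∘ g ≡ v ∘ g) one
    -- inside the first copy.
    first-copy-preserves : ∀ {D} ((e , _) : TopCocone diagram D) →
      PreservesEquations A (λ u → e (inj₁ u))
    first-copy-preserves (e , comm) u v f g uf≡vg =
      trans (across u f v g uf≡vg) (sym (across v g v g refl))
      where
      across : ∀ u f v g → u ∘ f ≡ v ∘ g → e (inj₁ u) ∘ f ≡ e (inj₂ v) ∘ g
      across u f v g uf≡vg =
        trans (comm ((u , f) , (v , g)))
              (cong (λ (w , h) → e (inj₂ w) ∘ h) (partner-equal (u , f) (v , g) uf≡vg))

  transfer-equations : LocallyFinite 𝐂 → ∀ {p} (P : Obj → Set p) →
    ClosedForBinaryDiagrams 𝐂 P → ∀ {A B} → P A → P B → (C : Obj) →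
    Σ Obj λ D → P D × Σ (Hom B C → Hom B D) (PreservesEquations A)
  transfer-equations lf P cl {A} {B} pA pB C =
    let D , pD , cocone = closed-finite cl pA pB diagram tautological
    in  D , pD , (λ u → proj₁ cocone (inj₁ u)) , first-copy-preserves cocone
    where open EquationDiagram lf A B C

  -- If e preserves equations, w ∘ f ↦ e w ∘ f is well defined, so colourings
  -- of hom(A,D) pull back to hom(A,C) and C →can (B)^A gives D →can (B)^A.
  canArrow-transfer : LocallyFinite 𝐂 → ∀ {A B C D} (e : Hom B C → Hom B D) →
    PreservesEquations A e → CanArrow 𝐂 C B A → CanArrow 𝐂 D B A
  canArrow-transfer lf {A} {B} {C} e e-pres C→B^A χ =
    let w , Q , q , iff = C→B^A χ′
    in  e w , Q , q , λ f g → ≡-⇔-rewrite (χ′-spec w f) (χ′-spec w g) (iff f g)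
    where
    pulled-back : Σ (Hom A C → ℕ) λ χ′ → ∀ ((u , f) : Hom B C × Hom A B) → χ′ (u ∘ f) ≡ χ (e u ∘ f)
    pulled-back =
      descend (finite-× (lf B C) (lf A B)) (hom-≟ lf) (λ (u , f) → u ∘ f)
              (λ (u , f) → χ (e u ∘ f)) 0
              (λ (u , f) (v , g) uf≡vg → cong χ (e-pres u v f g uf≡vg))

    χ′ : Hom A C → ℕ
    χ′ = proj₁ pulled-back

    χ′-spec : ∀ u f → χ′ (u ∘ f) ≡ χ (e u ∘ f)
    χ′-spec u f = proj₂ pulled-back (u , f)

  -- An arrow C →can (B)^A in C between objects of a hereditary subcategory
  -- is an arrow there: the witness Q maps into A, hence lies in P.
  canArrow-restrict : ∀ {p} (P : Obj → Set p) → Hereditary 𝐂 P →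
    ∀ {A B C} (pA : P A) (pB : P B) (pC : P C) →
    CanArrow 𝐂 C B A → CanArrow (FullSub 𝐂 P) (C , pC) (B , pB) (A , pA)
  canArrow-restrict P her {A} pA _ _ C→B^A χ =
    let w , Q , q , iff = C→B^A χ
    in  w , (Q , her Q A pA q) , q , iff

theorem4p1 : ∀ {o ℓ p : Level} (𝐂 : Category o ℓ) → AllMonic 𝐂 → LocallyFinite 𝐂 →
    (P : Category.Obj 𝐂 → Set p) → Hereditary 𝐂 P →
    CanonicalRamsey 𝐂 → ClosedForBinaryDiagrams 𝐂 P →
    CanonicalRamsey (FullSub 𝐂 P)
theorem4p1 𝐂 _ lf P her ramsey cl (A , pA) (B , pB) h =
  let C , C→B^A          = ramsey A B h
      D , pD , e , e-pres = transfer-equations 𝐂 lf P cl pA pB C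
  in  (D , pD) , canArrow-restrict 𝐂 P her pA pB pD
                     (canArrow-transfer 𝐂 lf e e-pres C→B^A)
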